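{- Let $T$ be a string of length $n$ whose last character $T[n]=\$$ is strictly smaller than every other character and occurs nowhere else in $T$. Let $i\in\{2,\dots,n\}$ and let $\lambda$ be the position in $\mathsf{SA}_s$ such that $\mathsf{SA}_s[\lambda]$ is the largest value in $\mathsf{SA}_s$ that is less than $i+1$. Then there exists a position $u$ in $T$ with $u\ne\mathsf{SA}_s[\lambda]$ such that the substring $T[\mathsf{SA}_s[\lambda]..i-1]$ is a common prefix of the two suffixes $T[u..n]$ and $T[\mathsf{SA}_s[\lambda]..n]$.
   Context: $S[a..b]$ denotes the substring from position $a$ to $b$, and is the empty string unless $1\le a\le b\le|S|$. The suffix array $\mathsf{SA}$ of $T$ is the permutation of $\{1,\dots,n\}$ with $T[\mathsf{SA}[1]..n]\prec\cdots\prec T[\mathsf{SA}[n]..n]$ lexicographically. The BWT $L$ of $T$ is defined by $L[k]=T[\mathsf{SA}[k]-1]$ for $\mathsf{SA}[k]\ge2$ and $L[k]=T[n]$ if $\mathsf{SA}[k]=1$. A run of $L$ is a maximal block of equal consecutive characters; let the runs of $L$ start at positions $t_1=1<t_2<\dots<t_r$. The sampled suffix array is $\mathsf{SA}_s=\mathsf{SA}[t_1],\mathsf{SA}[t_2],\dots,\mathsf{SA}[t_r]$ (it always contains the value $1$, so $\lambda$ is well defined). -}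

module Defs where

open import Data.Nat using (ℕ; zero; suc; _∸_; _≤_; _<_; _≥_)
open import Data.List using (List; []; _∷_; length; drop; take)
open import Data.List.Relation.Binary.Lex.Strict using (Lex-<)
open import Data.List.Relation.Binary.Prefix.Heterogeneous using (Prefix)
open import Data.Product using (_×_; Σ; ∃)
open import Data.Sum using (_⊎_)
open import Relation.Binary.PropositionalEquality using (_≡_)
open import Relation.Nullary using (¬_)

-- Strings are lists of characters; characters are natural numbers with the
-- usual order (any totally ordered alphabet).  Positions are 1-based.

-- T[p] (1-based); out-of-range positions return 0 (never used in range).
at : List ℕ → ℕ → ℕ
at []       _             = 0
at (c ∷ cs) zero          = 0
at (c ∷ cs) (suc zero)    = c
at (c ∷ cs) (suc (suc p)) = at cs (suc p)

suf : List ℕ → ℕ → List ℕ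
suf T p = drop (p ∸ 1) T

-- substring T[a..b]  (empty unless a ≤ b; used here with 1 ≤ a, b ≤ n)
sub : List ℕ → ℕ → ℕ → List ℕ
sub T a b = take (suc b ∸ a) (suf T a)

-- strict lexicographic order on strings (a proper prefix is smaller)
_≺_ : List ℕ → List ℕ → Set
_≺_ = Lex-< _≡_ _<_

DollarTerminated : List ℕ → Set
DollarTerminated T = ∀ j → 1 ≤ j → j < length T → at T (length T) < at T j

-- SA (as a function on 1..n) is the suffix array of T: it maps 1..n into
-- 1..n and lists the suffixes in strictly increasing lexicographic order
-- (hence it is injective, hence a permutation of 1..n).
IsSuffixArray : List ℕ → (ℕ → ℕ) → Set
IsSuffixArray T SA =
  (∀ k → 1 ≤ k → k ≤ length T → (1 ≤ SA k) × (SA k ≤ length T)) ×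
  (∀ k k' → 1 ≤ k → k < k' → k' ≤ length T → suf T (SA k) ≺ suf T (SA k'))

bwt : List ℕ → (ℕ → ℕ) → ℕ → ℕ
bwt T SA k with SA k
... | zero        = at T (length T)
... | suc zero    = at T (length T)
... | suc (suc p) = at T (suc p)

RunStart : List ℕ → (ℕ → ℕ) → ℕ → Set
RunStart T SA t =
  (t ≡ 1) ⊎ ((2 ≤ t) × (t ≤ length T) × ¬ (bwt T SA t ≡ bwt T SA (t ∸ 1)))

InSampledSA : List ℕ → (ℕ → ℕ) → ℕ → Set
InSampledSA T SA v = Σ ℕ λ t → RunStart T SA t × (SA t ≡ v)

IsLambdaValue : List ℕ → (ℕ → ℕ) → ℕ → ℕ → Set
IsLambdaValue T SA i v =
  InSampledSA T SA v × (v ≤ i) × (∀ w → InSampledSA T SA w → w ≤ i → w ≤ v)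

IsPrefixOf : List ℕ → List ℕ → Set
IsPrefixOf = Prefix _≡_

-- Every position p with s < p ≤ i is not sampled: if SA[k + 1] = p then L[k + 1] = L[k].
-- Walk p down from i to s, keeping q, the SA-predecessor of the suffix at p, together with
-- the fact that T[p..i-1] is a prefix of the suffix at q. At p = i the prefix is empty.
-- Going from p + 1 to p: L[k] = L[k + 1] = T[p] gives T[q - 1] = T[p] (q ≠ 1 since $ is
-- unique and smallest), and the LF-mapping sends the consecutive ranks of q and p + 1 to
-- consecutive ranks of q - 1 and p, extending the shared prefix by one character.
-- At p = s the predecessor q is the required u ≠ s. (If s = i the substring is empty.)

module Submission where

open import Defs
open import Data.Nat using (ℕ; zero; suc; _≤_; _<_; _∸_; _+_; z≤n; s≤s; s≤s⁻¹; _≤?_; _≟_)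
open import Data.Nat.Properties
open import Data.Fin using (Fin; toℕ; fromℕ<; punchOut)
import Data.Fin.Properties as Finₚ
open import Data.List using (List; []; _∷_; length; take)
open import Data.List.Properties using (drop-all)
open import Data.List.Relation.Binary.Lex.Strict using (this; next; <-asymmetric; xs≮[])
open import Data.List.Relation.Binary.Prefix.Heterogeneous using ([]; _∷_)
open import Data.Product using (_×_; Σ; ∃; _,_; proj₁; proj₂)
open import Data.Sum using (inj₁; inj₂)
open import Data.Empty using (⊥; ⊥-elim)
open import Function using (_∘_)
open import Function.Definitions using (Injective)
open import Relation.Binary.PropositionalEquality
open import Relation.Binary.Definitions using (tri<; tri≈; tri>)
open import Relation.Nullary using (¬_; yes; no; contradiction)

Fin-injective⇒surjective : ∀ {n} {f : Fin n → Fin n} → Injective _≡_ _≡_ f →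
                           ∀ y → ∃ λ x → f x ≡ y
Fin-injective⇒surjective {zero}  _     ()
Fin-injective⇒surjective {suc m} {f} f-inj y with Finₚ.any? (λ x → f x Finₚ.≟ y)
... | yes hit = hit
... | no miss = ⊥-elim (Finₚ.<⇒notInjective (n<1+n m) g-inj)
  where
  y≢f : ∀ x → ¬ y ≡ f x
  y≢f x y≡fx = miss (x , sym y≡fx)
  g : Fin (suc m) → Fin m
  g x = punchOut (y≢f x)
  g-inj : Injective _≡_ _≡_ g
  g-inj {x} {x′} = f-inj ∘ Finₚ.punchOut-injective (y≢f x) (y≢f x′)

injective⇒surjective-[1,n] : ∀ n (f : ℕ → ℕ) →
  (∀ {k} → 1 ≤ k → k ≤ n → 1 ≤ f k × f k ≤ n) →
  (∀ {a b} → 1 ≤ a → a ≤ n → 1 ≤ b → b ≤ n → f a ≡ f b → a ≡ b) →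
  ∀ {p} → 1 ≤ p → p ≤ n → ∃ λ k → 1 ≤ k × k ≤ n × f k ≡ p
injective⇒surjective-[1,n] n f f-range f-inj 1≤p p≤n =
  let x , Fx≡ = Fin-injective⇒surjective F-inj (fromPos 1≤p p≤n) in
  toPos x , s≤s z≤n , Finₚ.toℕ<n x ,
  trans (sym (toPos-F x)) (trans (cong toPos Fx≡) (toPos-fromPos 1≤p p≤n))
  where
  toPos : Fin n → ℕ
  toPos x = suc (toℕ x)
  fromPos : ∀ {v} → 1 ≤ v → v ≤ n → Fin n
  fromPos {suc v} _ v<n = fromℕ< v<n
  toPos-fromPos : ∀ {v} (1≤v : 1 ≤ v) (v≤n : v ≤ n) → toPos (fromPos 1≤v v≤n) ≡ v
  toPos-fromPos {suc v} _ v<n = cong suc (Finₚ.toℕ-fromℕ< v<n)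
  F : Fin n → Fin n
  F x = fromPos (proj₁ (f-range (s≤s z≤n) (Finₚ.toℕ<n x)))
                (proj₂ (f-range (s≤s z≤n) (Finₚ.toℕ<n x)))
  toPos-F : ∀ x → toPos (F x) ≡ f (toPos x)
  toPos-F x = toPos-fromPos _ _
  F-inj : Injective _≡_ _≡_ F
  F-inj {x} {y} Fx≡Fy = Finₚ.toℕ-injective (suc-injective
    (f-inj (s≤s z≤n) (Finₚ.toℕ<n x) (s≤s z≤n) (Finₚ.toℕ<n y)
      (trans (sym (toPos-F x)) (trans (cong toPos Fx≡Fy) (toPos-F y)))))

≺-asym : ∀ {xs ys} → xs ≺ ys → ¬ ys ≺ xs
≺-asym = <-asymmetric sym (resp₂ _<_) <-asym

≺-irrefl : ∀ {xs} → ¬ xs ≺ xs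
≺-irrefl xs≺xs = ≺-asym xs≺xs xs≺xs

≺-between-cons : ∀ {c xs ys zs} → (c ∷ xs) ≺ zs → zs ≺ (c ∷ ys) →
                 ∃ λ zs′ → zs ≡ c ∷ zs′ × xs ≺ zs′ × zs′ ≺ ys
≺-between-cons (this c<d)      (this d<c)      = ⊥-elim (<-asym c<d d<c)
≺-between-cons (this c<c)      (next refl _)   = ⊥-elim (<-irrefl refl c<c)
≺-between-cons (next refl _)   (this c<c)      = ⊥-elim (<-irrefl refl c<c)
≺-between-cons (next refl xs≺) (next _ ≺ys)    = _ , refl , xs≺ , ≺ys

take-prefix : ∀ m (xs : List ℕ) → IsPrefixOf (take m xs) xs
take-prefix zero    xs       = []
take-prefix (suc m) []       = []
take-prefix (suc m) (x ∷ xs) = refl ∷ take-prefix m xs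

suf-cons : ∀ T j → j < length T → suf T (suc j) ≡ at T (suc j) ∷ suf T (suc (suc j))
suf-cons (c ∷ cs) zero    _         = refl
suf-cons (c ∷ cs) (suc j) (s≤s j<n) = suf-cons cs j j<n

suf-tail : ∀ T {z c zs} → 1 ≤ z → suf T z ≡ c ∷ zs → zs ≡ suf T (suc z)
suf-tail (x ∷ xs) {suc zero}    _ refl = refl
suf-tail (x ∷ xs) {suc (suc z)} _ eq   = suf-tail xs (s≤s z≤n) eq

suf-beyond : ∀ T {z} → length T < z → suf T z ≡ []
suf-beyond T {suc z} (s≤s n≤z) = drop-all z T n≤z

sub-cons : ∀ T j b → j < length T → suc j ≤ b →
           sub T (suc j) b ≡ at T (suc j) ∷ sub T (suc (suc j)) b
sub-cons T j (suc b) j<n (s≤s j≤b)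
  rewrite +-∸-assoc 1 j≤b | suf-cons T j j<n = refl

sub-empty-prefix : ∀ T b xs → IsPrefixOf (sub T (suc b) b) xs
sub-empty-prefix T b xs rewrite n∸n≡0 b = []

sub-prefix-suf : ∀ T a b → IsPrefixOf (sub T a b) (suf T a)
sub-prefix-suf T a b = take-prefix (suc b ∸ a) (suf T a)

module SuffixArray (T : List ℕ) (SA : ℕ → ℕ) (isSA : IsSuffixArray T SA) where

  n : ℕ
  n = length T

  SA-range : ∀ {k} → 1 ≤ k → k ≤ n → 1 ≤ SA k × SA k ≤ n
  SA-range = proj₁ isSA _

  SA-sorted : ∀ {k k′} → 1 ≤ k → k < k′ → k′ ≤ n → suf T (SA k) ≺ suf T (SA k′)
  SA-sorted = proj₂ isSA _ _

  SA-reflects-≺ : ∀ {a b} → 1 ≤ a → a ≤ n → 1 ≤ b → b ≤ n →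
                  suf T (SA a) ≺ suf T (SA b) → a < b
  SA-reflects-≺ {a} {b} 1≤a a≤n 1≤b b≤n a≺b with <-cmp a b
  ... | tri< a<b _ _ = a<b
  ... | tri≈ _ refl _ = ⊥-elim (≺-irrefl a≺b)
  ... | tri> _ _ b<a = ⊥-elim (≺-asym a≺b (SA-sorted 1≤b b<a a≤n))

  SA-injective : ∀ {a b} → 1 ≤ a → a ≤ n → 1 ≤ b → b ≤ n → SA a ≡ SA b → a ≡ b
  SA-injective {a} {b} 1≤a a≤n 1≤b b≤n SAa≡SAb with <-cmp a b
  ... | tri< a<b _ _ =
    ⊥-elim (≺-irrefl (subst (λ v → suf T v ≺ suf T (SA b)) SAa≡SAb (SA-sorted 1≤a a<b b≤n)))
  ... | tri≈ _ a≡b _ = a≡b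
  ... | tri> _ _ b<a =
    ⊥-elim (≺-irrefl (subst (λ v → suf T v ≺ suf T (SA a)) (sym SAa≡SAb) (SA-sorted 1≤b b<a a≤n)))

  SA-surjective : ∀ {p} → 1 ≤ p → p ≤ n → ∃ λ k → 1 ≤ k × k ≤ n × SA k ≡ p
  SA-surjective = injective⇒surjective-[1,n] n SA SA-range SA-injective

  Adjacent : ℕ → ℕ → Set
  Adjacent q p = ∃ λ k → 1 ≤ k × suc k ≤ n × SA k ≡ q × SA (suc k) ≡ p

  adjacent-rangeˡ : ∀ {q p} → Adjacent q p → 1 ≤ q × q ≤ n
  adjacent-rangeˡ (k , 1≤k , k<n , refl , _) = SA-range 1≤k (<⇒≤ k<n)

  adjacent-rangeʳ : ∀ {q p} → Adjacent q p → 1 ≤ p × p ≤ n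
  adjacent-rangeʳ (k , _ , k<n , _ , refl) = SA-range (s≤s z≤n) k<n

  adjacent-≺ : ∀ {q p} → Adjacent q p → suf T q ≺ suf T p
  adjacent-≺ (k , 1≤k , k<n , refl , refl) = SA-sorted 1≤k (n<1+n k) k<n

  adjacent-distinct : ∀ {q p} → Adjacent q p → ¬ q ≡ p
  adjacent-distinct adj refl = ≺-irrefl (adjacent-≺ adj)

  no-suffix-between-adjacent : ∀ {q p} → Adjacent q p → ∀ {z} → 1 ≤ z →
                               suf T q ≺ suf T z → suf T z ≺ suf T p → ⊥
  no-suffix-between-adjacent (k , 1≤k , k<n , refl , refl) {z} 1≤z q≺z z≺p with z ≤? n
  ... | no z≰n = xs≮[] (subst (_ ≺_) (suf-beyond T (≰⇒> z≰n)) q≺z)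
  ... | yes z≤len =
    let m , 1≤m , m≤n , SAm≡z = SA-surjective 1≤z z≤len
        k<m = SA-reflects-≺ 1≤k (<⇒≤ k<n) 1≤m m≤n
                (subst (λ v → _ ≺ suf T v) (sym SAm≡z) q≺z)
        m<k+1 = SA-reflects-≺ 1≤m m≤n (s≤s z≤n) k<n
                  (subst (λ v → suf T v ≺ _) (sym SAm≡z) z≺p)
    in <⇒≱ k<m (s≤s⁻¹ m<k+1)

  module _ {x y} (adj : Adjacent (suc (suc x)) (suc (suc y)))
           (cx≡cy : at T (suc x) ≡ at T (suc y)) where

    private
      c : ℕ
      c = at T (suc x)

      x+1<n : suc x < n
      x+1<n = proj₂ (adjacent-rangeˡ adj)

      y+1<n : suc y < n
      y+1<n = proj₂ (adjacent-rangeʳ adj)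

      suf-x : suf T (suc x) ≡ c ∷ suf T (suc (suc x))
      suf-x = suf-cons T x (<⇒≤ x+1<n)

      suf-y : suf T (suc y) ≡ c ∷ suf T (suc (suc y))
      suf-y = trans (suf-cons T y (<⇒≤ y+1<n)) (cong (_∷ _) (sym cx≡cy))

    pred-≺ : suf T (suc x) ≺ suf T (suc y)
    pred-≺ = subst₂ _≺_ (sym suf-x) (sym suf-y) (next refl (adjacent-≺ adj))

    no-suffix-between-pred : ∀ {z} → 1 ≤ z →
                             suf T (suc x) ≺ suf T z → suf T z ≺ suf T (suc y) → ⊥
    no-suffix-between-pred {z} 1≤z x≺z z≺y
      with zs , z≡ , x≺zs , zs≺y ← ≺-between-cons (subst (_≺ suf T z) suf-x x≺z)
                                                   (subst (suf T z ≺_) suf-y z≺y)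
      with refl ← suf-tail T {z} 1≤z z≡
      = no-suffix-between-adjacent adj {suc z} (s≤s z≤n) x≺zs zs≺y

    -- LF-mapping: equal BWT characters at consecutive ranks k, k + 1 send them to consecutive ranks.
    LF-successor : ∀ {a b} → 1 ≤ a → a ≤ n → SA a ≡ suc x →
                   1 ≤ b → b ≤ n → SA b ≡ suc y → b ≡ suc a
    LF-successor {a} {b} 1≤a a≤n SAa≡ 1≤b b≤n SAb≡ with b ≤? suc a
    ... | yes b≤a+1 = ≤-antisym b≤a+1 (SA-reflects-≺ 1≤a a≤n 1≤b b≤n
            (subst₂ (λ u v → suf T u ≺ suf T v) (sym SAa≡) (sym SAb≡) pred-≺))
    ... | no b≰a+1 = ⊥-elim (no-suffix-between-pred (proj₁ (SA-range (s≤s z≤n) a+1≤n))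
            (subst (λ u → suf T u ≺ suf T (SA (suc a))) SAa≡ (SA-sorted 1≤a (n<1+n a) a+1≤n))
            (subst (λ v → suf T (SA (suc a)) ≺ suf T v) SAb≡ (SA-sorted (s≤s z≤n) a+1<b b≤n)))
      where
      a+1<b : suc a < b
      a+1<b = ≰⇒> b≰a+1
      a+1≤n : suc a ≤ n
      a+1≤n = <⇒≤ (<-≤-trans a+1<b b≤n)

    adjacent-LF : Adjacent (suc x) (suc y)
    adjacent-LF
      with a , 1≤a , a≤n , SAa≡ ← SA-surjective (s≤s z≤n) (<⇒≤ x+1<n)
         | b , 1≤b , b≤n , SAb≡ ← SA-surjective (s≤s z≤n) (<⇒≤ y+1<n)
      with refl ← LF-successor 1≤a a≤n SAa≡ 1≤b b≤n SAb≡
      = a , 1≤a , b≤n , SAa≡ , SAb≡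

  bwt-pred : ∀ {k j} → SA k ≡ suc (suc j) → bwt T SA k ≡ at T (suc j)
  bwt-pred SAk≡ rewrite SAk≡ = refl

  bwt-first : ∀ {k} → SA k ≡ 1 → bwt T SA k ≡ at T n
  bwt-first SAk≡ rewrite SAk≡ = refl

  sampled-positive : 1 ≤ n → ∀ {v} → InSampledSA T SA v → 1 ≤ v
  sampled-positive 1≤n (_ , inj₁ refl           , refl) = proj₁ (SA-range ≤-refl 1≤n)
  sampled-positive _   (_ , inj₂ (2≤t , t≤n , _) , refl) =
    proj₁ (SA-range (≤-trans (s≤s z≤n) 2≤t) t≤n)

  unsampled-bwt : ∀ {p} → ¬ InSampledSA T SA p → ∀ {k} → 1 ≤ k → suc k ≤ n →
                  SA (suc k) ≡ p → bwt T SA (suc k) ≡ bwt T SA k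
  unsampled-bwt unsampled {k} 1≤k k<n SAk+1≡ with bwt T SA (suc k) ≟ bwt T SA k
  ... | yes same = same
  ... | no differ = ⊥-elim (unsampled (suc k , inj₂ (s≤s 1≤k , k<n , differ) , SAk+1≡))

  unsampled⇒adjacent : ∀ {p} → ¬ InSampledSA T SA p → 1 ≤ p → p ≤ n → ∃ λ q → Adjacent q p
  unsampled⇒adjacent unsampled 1≤p p≤n with SA-surjective 1≤p p≤n
  ... | suc zero    , _ , _   , SA1≡  = ⊥-elim (unsampled (1 , inj₁ refl , SA1≡))
  ... | suc (suc k) , _ , k<n , SAk+1≡ = SA (suc k) , suc k , s≤s z≤n , k<n , refl , SAk+1≡

  PredecessorSharesPrefix : ℕ → ℕ → Set
  PredecessorSharesPrefix p b = ∃ λ q → Adjacent q p × IsPrefixOf (sub T p b) (suf T q)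

  extend-left : DollarTerminated T → ∀ {p b} → ¬ InSampledSA T SA (suc p) → 1 ≤ p → p ≤ b →
                PredecessorSharesPrefix (suc p) b → PredecessorSharesPrefix p b
  extend-left _ {zero} _ () _ _
  extend-left _ _ _ _ (zero , adj , _) = contradiction (proj₁ (adjacent-rangeˡ adj)) λ ()
  -- q = 1 would put $ at L[k] next to T[p] at L[k + 1].
  extend-left dol {suc p} unsampled _ _ (suc zero , adj@(k , 1≤k , k<n , SAk≡q , SAk+1≡) , _) =
    contradiction same-char (<⇒≢ (dol (suc p) (s≤s z≤n) (proj₂ (adjacent-rangeʳ adj))))
    where
    same-char : at T n ≡ at T (suc p)
    same-char = trans (sym (bwt-first SAk≡q))
                (trans (sym (unsampled-bwt unsampled 1≤k k<n SAk+1≡)) (bwt-pred SAk+1≡))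
  extend-left dol {suc p} {b} unsampled _ p<b
              (suc (suc q) , adj@(k , 1≤k , k<n , SAk≡q , SAk+1≡) , prefix) =
    suc q , adjacent-LF adj same-char ,
    subst₂ IsPrefixOf (sym (sub-cons T p b p<n p<b)) (sym (suf-cons T q q<n)) (sym same-char ∷ prefix)
    where
    same-char : at T (suc q) ≡ at T (suc p)
    same-char = trans (sym (bwt-pred SAk≡q))
                (trans (sym (unsampled-bwt unsampled 1≤k k<n SAk+1≡)) (bwt-pred SAk+1≡))
    p<n : p < n
    p<n = <⇒≤ (proj₂ (adjacent-rangeʳ adj))
    q<n : q < n
    q<n = <⇒≤ (proj₂ (adjacent-rangeˡ adj))

  predecessor-shares-prefix : DollarTerminated T → ∀ {s b} → 1 ≤ s → s ≤ b → suc b ≤ n →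
                              (∀ {p} → s < p → p ≤ suc b → ¬ InSampledSA T SA p) →
                              PredecessorSharesPrefix s b
  predecessor-shares-prefix dol {s} {b} 1≤s s≤b b<n unsampled =
    walk (suc b ∸ s) (m∸n+n≡m (m≤n⇒m≤1+n s≤b)) ≤-refl
    where
    walk : ∀ d {p} → d + p ≡ suc b → s ≤ p → PredecessorSharesPrefix p b
    walk zero refl _ =
      let q , adj = unsampled⇒adjacent (unsampled (s≤s s≤b) ≤-refl) (s≤s z≤n) b<n
      in q , adj , sub-empty-prefix T b (suf T q)
    walk (suc d) {p} d+1+p≡b+1 s≤p =
      extend-left dol (unsampled (s≤s s≤p) p<b+1) (≤-trans 1≤s s≤p) (s≤s⁻¹ p<b+1)
        (walk d (trans (+-suc d p) d+1+p≡b+1) (m≤n⇒m≤1+n s≤p))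
      where
      p<b+1 : p < suc b
      p<b+1 = subst (p <_) d+1+p≡b+1 (s≤s (m≤n+m p d))

lemma18 : (T : List ℕ) → DollarTerminated T →
          (SA : ℕ → ℕ) → IsSuffixArray T SA →
          (i : ℕ) → 2 ≤ i → i ≤ length T →
          (s : ℕ) → IsLambdaValue T SA i s →
          Σ ℕ λ u → (1 ≤ u) × (u ≤ length T) × ¬ (u ≡ s) ×
            IsPrefixOf (sub T s (i ∸ 1)) (suf T u) ×
            IsPrefixOf (sub T s (i ∸ 1)) (suf T s)
lemma18 T dol SA isSA (suc b) (s≤s 1≤b) b<n s (s-sampled , s≤b+1 , s-max) with s ≟ suc b
... | yes refl = 1 , ≤-refl , ≤-trans (s≤s z≤n) b<n , (λ 1≡b+1 → <-irrefl 1≡b+1 (s≤s 1≤b)) ,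
                 sub-empty-prefix T b (suf T 1) , sub-empty-prefix T b (suf T (suc b))
... | no s≢b+1 =
  let q , adj , prefix =
        predecessor-shares-prefix dol 1≤s (s≤s⁻¹ (≤∧≢⇒< s≤b+1 s≢b+1)) b<n unsampled
  in q , proj₁ (adjacent-rangeˡ adj) , proj₂ (adjacent-rangeˡ adj) , adjacent-distinct adj ,
    prefix , sub-prefix-suf T s b
  where
  open SuffixArray T SA isSA
  1≤s : 1 ≤ s
  1≤s = sampled-positive (≤-trans (s≤s z≤n) b<n) s-sampled
  unsampled : ∀ {p} → s < p → p ≤ suc b → ¬ InSampledSA T SA p
  unsampled s<p p≤b+1 p-sampled = <⇒≱ s<p (s-max _ p-sampled p≤b+1)
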